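{- Let $A$ be a pseudo-BCI algebra and let $d$ be a type II symmetric derivation on $A$. Then for all $x\in A$: (1) $d(1)=d(x)\to x=d(x)\rightsquigarrow x$; (2) $d(x)=\varphi_{d(x)\Cup_1 x}=\varphi_{d(x)\Cup_2 x}$; (3) $d(x)=d(x)\Cup_1 x=d(x)\Cup_2 x$; (4) $d(x)\in\mathrm{At}(A)$; (5) if $d(1)=1$, then $d=\mathrm{Id}_A$.
   Context: A pseudo-BCI algebra is a structure $(A,\to,\rightsquigarrow,1)$ of type $(2,2,0)$ such that for all $x,y,z\in A$: $(x\to y)\rightsquigarrow[(y\to z)\rightsquigarrow(x\to z)]=1$; $(x\rightsquigarrow y)\to[(y\rightsquigarrow z)\to(x\rightsquigarrow z)]=1$; $1\to x=x$; $1\rightsquigarrow x=x$; and $x\to y=1$, $y\to x=1$ imply $x=y$. Write $x\le y$ iff $x\to y=1$. $\mathrm{At}(A)$ is the set of atoms, i.e. elements $a$ such that $a\le x$ implies $x=a$. Put $x\Cup_1 y=(x\to y)\rightsquigarrow y$, $x\Cup_2 y=(x\rightsquigarrow y)\to y$ and $\varphi_z=(z\to 1)\rightsquigarrow 1$. A map $d:A\to A$ is a type II symmetric derivation if $d(x\to y)=(d(x)\to y)\Cup_2(d(y)\to x)$ and $d(x\rightsquigarrow y)=(d(x)\rightsquigarrow y)\Cup_1(d(y)\rightsquigarrow x)$ for all $x,y\in A$. -}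

module Defs where

open import Level using (Level; suc)
open import Relation.Binary.PropositionalEquality using (_≡_)
open import Data.Product using (_×_)

record PseudoBCI (a : Level) : Set (suc a) where
  infixr 5 _⇒_ _⇝_
  field
    Carrier : Set a
    _⇒_ : Carrier → Carrier → Carrier
    _⇝_ : Carrier → Carrier → Carrier
    𝟏 : Carrier
    ax1 : ∀ x y z → ((x ⇒ y) ⇝ ((y ⇒ z) ⇝ (x ⇒ z))) ≡ 𝟏
    ax2 : ∀ x y z → ((x ⇝ y) ⇒ ((y ⇝ z) ⇒ (x ⇝ z))) ≡ 𝟏
    ax3 : ∀ x → (𝟏 ⇒ x) ≡ x
    ax4 : ∀ x → (𝟏 ⇝ x) ≡ x
    ax5 : ∀ x y → (x ⇒ y) ≡ 𝟏 → (y ⇒ x) ≡ 𝟏 → x ≡ y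

  _≤_ : Carrier → Carrier → Set a
  x ≤ y = (x ⇒ y) ≡ 𝟏

  _⋓₁_ : Carrier → Carrier → Carrier
  x ⋓₁ y = (x ⇒ y) ⇝ y

  _⋓₂_ : Carrier → Carrier → Carrier
  x ⋓₂ y = (x ⇝ y) ⇒ y

  φ : Carrier → Carrier
  φ z = (z ⇒ 𝟏) ⇝ 𝟏

  IsAtom : Carrier → Set a
  IsAtom a = ∀ x → a ≤ x → x ≡ a

  IsTypeIISymDerivation : (Carrier → Carrier) → Set a
  IsTypeIISymDerivation d =
    (∀ x y → d (x ⇒ y) ≡ ((d x ⇒ y) ⋓₂ (d y ⇒ x))) ×
    (∀ x y → d (x ⇝ y) ≡ ((d x ⇝ y) ⋓₁ (d y ⇝ x)))

{-# OPTIONS --safe #-}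
-- Writing c = d 𝟏, the derivation rules at x ⇒ x, x ⇝ x, 𝟏 ⇒ x and 𝟏 ⇝ x give
-- c = d x ⇒ x = d x ⇝ x and d x = c ⇒ x = c ⇝ x, i.e. d x = d x ⋓₁ x = d x ⋓₂ x.
-- Atomicity: if d x ≤ z then w = z ⇝ x ≤ d x ⇝ x = c, and d w = φ (d z ⇝ x) is an
-- atom (every φ u is one) with d w = c ⇒ w ≤ c ⇒ c = 𝟏; so d w = 𝟏, hence w = c,
-- which forces z ≤ d x. Items (2) and (5) then follow since u ≤ φ u.
module Submission where

open import Defs
open import Level using (Level)
open import Relation.Binary.PropositionalEquality
  using (_≡_; sym; trans; cong; cong₂; subst; module ≡-Reasoning)
open import Data.Product using (_×_; _,_; proj₁; proj₂)

module Properties {a : Level} (A : PseudoBCI a) where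
  open PseudoBCI A
  open ≡-Reasoning

  x⇒x≡𝟏 : ∀ x → x ⇒ x ≡ 𝟏
  x⇒x≡𝟏 x = begin
    x ⇒ x                                ≡⟨ sym (ax3 (x ⇒ x)) ⟩
    𝟏 ⇒ (x ⇒ x)                          ≡⟨ sym (cong₂ _⇒_ (ax4 𝟏) (cong₂ _⇒_ (ax4 x) (ax4 x))) ⟩
    (𝟏 ⇝ 𝟏) ⇒ ((𝟏 ⇝ x) ⇒ (𝟏 ⇝ x))        ≡⟨ ax2 𝟏 𝟏 x ⟩
    𝟏                                    ∎

  x⇝x≡𝟏 : ∀ x → x ⇝ x ≡ 𝟏
  x⇝x≡𝟏 x = begin
    x ⇝ x                                ≡⟨ sym (ax4 (x ⇝ x)) ⟩
    𝟏 ⇝ (x ⇝ x)                          ≡⟨ sym (cong₂ _⇝_ (ax3 𝟏) (cong₂ _⇝_ (ax3 x) (ax3 x))) ⟩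
    (𝟏 ⇒ 𝟏) ⇝ ((𝟏 ⇒ x) ⇝ (𝟏 ⇒ x))        ≡⟨ ax1 𝟏 𝟏 x ⟩
    𝟏                                    ∎

  x⇝x⋓₁y≡𝟏 : ∀ x y → x ⇝ (x ⋓₁ y) ≡ 𝟏
  x⇝x⋓₁y≡𝟏 x y = trans (sym (cong₂ _⇝_ (ax3 x) (cong ((x ⇒ y) ⇝_) (ax3 y)))) (ax1 𝟏 x y)

  x≤x⋓₂y : ∀ x y → x ≤ (x ⋓₂ y)
  x≤x⋓₂y x y = trans (sym (cong₂ _⇒_ (ax4 x) (cong ((x ⇝ y) ⇒_) (ax4 y)))) (ax2 𝟏 x y)

  ≤⇒⇝≡𝟏 : ∀ {x y} → x ≤ y → x ⇝ y ≡ 𝟏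
  ≤⇒⇝≡𝟏 {x} {y} x≤y = trans (cong (x ⇝_) (sym (trans (cong (_⇝ y) x≤y) (ax4 y)))) (x⇝x⋓₁y≡𝟏 x y)

  ⇝≡𝟏⇒≤ : ∀ {x y} → x ⇝ y ≡ 𝟏 → x ≤ y
  ⇝≡𝟏⇒≤ {x} {y} x⇝y≡𝟏 = trans (cong (x ⇒_) (sym (trans (cong (_⇒ y) x⇝y≡𝟏) (ax3 y)))) (x≤x⋓₂y x y)

  ⇒-monoʳ-≤ : ∀ x {y z} → y ≤ z → (x ⇒ y) ≤ (x ⇒ z)
  ⇒-monoʳ-≤ x {y} {z} y≤z =
    ⇝≡𝟏⇒≤ (trans (cong ((x ⇒ y) ⇝_) (sym (trans (cong (_⇝ (x ⇒ z)) y≤z) (ax4 _)))) (ax1 x y z))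

  ⇒-antiˡ-≤ : ∀ {x y} z → x ≤ y → (y ⇒ z) ≤ (x ⇒ z)
  ⇒-antiˡ-≤ {x} {y} z x≤y =
    ⇝≡𝟏⇒≤ (trans (sym (trans (cong (_⇝ ((y ⇒ z) ⇝ (x ⇒ z))) x≤y) (ax4 _))) (ax1 x y z))

  ⇝-antiˡ-≤ : ∀ {x y} z → x ≤ y → (y ⇝ z) ≤ (x ⇝ z)
  ⇝-antiˡ-≤ {x} {y} z x≤y =
    trans (sym (trans (cong (_⇒ ((y ⇝ z) ⇒ (x ⇝ z))) (≤⇒⇝≡𝟏 x≤y)) (ax3 _))) (ax2 x y z)

  ≤-trans : ∀ {x y z} → x ≤ y → y ≤ z → x ≤ z
  ≤-trans {x} {y} {z} x≤y y≤z =
    trans (sym (trans (cong (_⇒ (x ⇒ z)) y≤z) (ax3 _))) (⇒-antiˡ-≤ z x≤y)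

  ⇒-⇝-exchange : ∀ x y z → x ⇒ (y ⇝ z) ≡ y ⇝ (x ⇒ z)
  ⇒-⇝-exchange x y z = ax5 _ _
    (≤-trans (⇝≡𝟏⇒≤ (ax1 x (y ⇝ z) z)) (⇝-antiˡ-≤ (x ⇒ z) (x≤x⋓₂y y z)))
    (≤-trans (ax2 y (x ⇒ z) z) (⇒-antiˡ-≤ (y ⇝ z) (⇝≡𝟏⇒≤ (x⇝x⋓₁y≡𝟏 x z))))

  x⇒𝟏≡x⇝𝟏 : ∀ x → x ⇒ 𝟏 ≡ x ⇝ 𝟏
  x⇒𝟏≡x⇝𝟏 x = begin
    x ⇒ 𝟏          ≡⟨ cong (x ⇒_) (sym (x⇝x≡𝟏 x)) ⟩
    x ⇒ (x ⇝ x)    ≡⟨ ⇒-⇝-exchange x x x ⟩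
    x ⇝ (x ⇒ x)    ≡⟨ cong (x ⇝_) (x⇒x≡𝟏 x) ⟩
    x ⇝ 𝟏          ∎

  ≤⇒⇒𝟏-cong : ∀ {x y} → y ≤ x → x ⇒ 𝟏 ≡ y ⇒ 𝟏
  ≤⇒⇒𝟏-cong {x} {y} y≤x = begin
    x ⇒ 𝟏          ≡⟨ cong (x ⇒_) (sym (≤⇒⇝≡𝟏 y≤x)) ⟩
    x ⇒ (y ⇝ x)    ≡⟨ ⇒-⇝-exchange x y x ⟩
    y ⇝ (x ⇒ x)    ≡⟨ cong (y ⇝_) (x⇒x≡𝟏 x) ⟩
    y ⇝ 𝟏          ≡⟨ sym (x⇒𝟏≡x⇝𝟏 y) ⟩
    y ⇒ 𝟏          ∎

  x≤φx : ∀ x → x ≤ φ x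
  x≤φx x = ⇝≡𝟏⇒≤ (x⇝x⋓₁y≡𝟏 x 𝟏)

  φ-idem : ∀ x → φ (φ x) ≡ φ x
  φ-idem x = cong (_⇝ 𝟏) (≤⇒⇒𝟏-cong (x≤φx x))

  φ-fixed⇒atom : ∀ {b} → φ b ≡ b → IsAtom b
  φ-fixed⇒atom {b} φb≡b z b≤z = ax5 z b z≤b b≤z
    where
    z≤b : z ≤ b
    z≤b = begin
      z ⇒ b                  ≡⟨ cong (z ⇒_) (sym φb≡b) ⟩
      z ⇒ ((b ⇒ 𝟏) ⇝ 𝟏)      ≡⟨ ⇒-⇝-exchange z (b ⇒ 𝟏) 𝟏 ⟩
      (b ⇒ 𝟏) ⇝ (z ⇒ 𝟏)      ≡⟨ cong ((b ⇒ 𝟏) ⇝_) (≤⇒⇒𝟏-cong b≤z) ⟩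
      (b ⇒ 𝟏) ⇝ (b ⇒ 𝟏)      ≡⟨ x⇝x≡𝟏 (b ⇒ 𝟏) ⟩
      𝟏                      ∎

  φ-atom : ∀ x → IsAtom (φ x)
  φ-atom x = φ-fixed⇒atom (φ-idem x)

module TypeIISymDerivation
  {a : Level} (A : PseudoBCI a) {d : PseudoBCI.Carrier A → PseudoBCI.Carrier A}
  (isDerivation : PseudoBCI.IsTypeIISymDerivation A d) where
  open PseudoBCI A
  open Properties A
  open ≡-Reasoning

  d-⇒ : ∀ x y → d (x ⇒ y) ≡ (d x ⇒ y) ⋓₂ (d y ⇒ x)
  d-⇒ = proj₁ isDerivation

  d-⇝ : ∀ x y → d (x ⇝ y) ≡ (d x ⇝ y) ⋓₁ (d y ⇝ x)
  d-⇝ = proj₂ isDerivation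

  d𝟏≡dx⇒x : ∀ x → d 𝟏 ≡ d x ⇒ x
  d𝟏≡dx⇒x x = begin
    d 𝟏                                      ≡⟨ cong d (sym (x⇒x≡𝟏 x)) ⟩
    d (x ⇒ x)                                ≡⟨ d-⇒ x x ⟩
    ((d x ⇒ x) ⇝ (d x ⇒ x)) ⇒ (d x ⇒ x)      ≡⟨ cong (_⇒ (d x ⇒ x)) (x⇝x≡𝟏 _) ⟩
    𝟏 ⇒ (d x ⇒ x)                            ≡⟨ ax3 _ ⟩
    d x ⇒ x                                  ∎

  d𝟏≡dx⇝x : ∀ x → d 𝟏 ≡ d x ⇝ x
  d𝟏≡dx⇝x x = begin
    d 𝟏                                      ≡⟨ cong d (sym (x⇝x≡𝟏 x)) ⟩
    d (x ⇝ x)                                ≡⟨ d-⇝ x x ⟩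
    ((d x ⇝ x) ⇒ (d x ⇝ x)) ⇝ (d x ⇝ x)      ≡⟨ cong (_⇝ (d x ⇝ x)) (x⇒x≡𝟏 _) ⟩
    𝟏 ⇝ (d x ⇝ x)                            ≡⟨ ax4 _ ⟩
    d x ⇝ x                                  ∎

  dx≡d𝟏⇒x : ∀ x → d x ≡ d 𝟏 ⇒ x
  dx≡d𝟏⇒x x = ax5 _ _ dx≤d𝟏⇒x d𝟏⇒x≤dx
    where
    dx≤d𝟏⇒x : d x ≤ (d 𝟏 ⇒ x)
    dx≤d𝟏⇒x = trans (cong (λ c → d x ⇒ (c ⇒ x)) (d𝟏≡dx⇝x x)) (x≤x⋓₂y (d x) x)
    d𝟏⇒x≤dx : (d 𝟏 ⇒ x) ≤ d x
    d𝟏⇒x≤dx = trans (cong ((d 𝟏 ⇒ x) ⇒_) (trans (cong d (sym (ax3 x))) (d-⇒ 𝟏 x))) (x≤x⋓₂y _ _)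

  dx≡d𝟏⇝x : ∀ x → d x ≡ d 𝟏 ⇝ x
  dx≡d𝟏⇝x x = ax5 _ _ dx≤d𝟏⇝x d𝟏⇝x≤dx
    where
    dx≤d𝟏⇝x : d x ≤ (d 𝟏 ⇝ x)
    dx≤d𝟏⇝x = ⇝≡𝟏⇒≤ (trans (cong (λ c → d x ⇝ (c ⇝ x)) (d𝟏≡dx⇒x x)) (x⇝x⋓₁y≡𝟏 (d x) x))
    d𝟏⇝x≤dx : (d 𝟏 ⇝ x) ≤ d x
    d𝟏⇝x≤dx = ⇝≡𝟏⇒≤ (trans (cong ((d 𝟏 ⇝ x) ⇝_) (trans (cong d (sym (ax4 x))) (d-⇝ 𝟏 x)))
                             (x⇝x⋓₁y≡𝟏 _ _))

  dx≡dx⋓₁x : ∀ x → d x ≡ d x ⋓₁ x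
  dx≡dx⋓₁x x = trans (dx≡d𝟏⇝x x) (cong (_⇝ x) (d𝟏≡dx⇒x x))

  dx≡dx⋓₂x : ∀ x → d x ≡ d x ⋓₂ x
  dx≡dx⋓₂x x = trans (dx≡d𝟏⇒x x) (cong (_⇒ x) (d𝟏≡dx⇝x x))

  ≤d𝟏⇒d≤𝟏 : ∀ {w} → w ≤ d 𝟏 → d w ≤ 𝟏
  ≤d𝟏⇒d≤𝟏 {w} w≤d𝟏 = begin
    d w ⇒ 𝟏                  ≡⟨ cong (_⇒ 𝟏) (dx≡d𝟏⇒x w) ⟩
    (d 𝟏 ⇒ w) ⇒ 𝟏            ≡⟨ cong ((d 𝟏 ⇒ w) ⇒_) (sym (x⇒x≡𝟏 (d 𝟏))) ⟩
    (d 𝟏 ⇒ w) ⇒ (d 𝟏 ⇒ d 𝟏)  ≡⟨ ⇒-monoʳ-≤ (d 𝟏) w≤d𝟏 ⟩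
    𝟏                        ∎

  d≡𝟏⇒≡d𝟏 : ∀ {w} → d w ≡ 𝟏 → w ≡ d 𝟏
  d≡𝟏⇒≡d𝟏 {w} dw≡𝟏 = sym (trans (d𝟏≡dx⇒x w) (trans (cong (_⇒ w) dw≡𝟏) (ax3 w)))

  d[z⇝x]≡φ : ∀ {x z} → d x ≤ z → d (z ⇝ x) ≡ φ (d z ⇝ x)
  d[z⇝x]≡φ {x} {z} dx≤z =
    trans (d-⇝ z x) (cong (λ t → ((d z ⇝ x) ⇒ t) ⇝ t) (≤⇒⇝≡𝟏 dx≤z))

  d-atom : ∀ x → IsAtom (d x)
  d-atom x z dx≤z = ax5 z (d x) z≤dx dx≤z
    where
    z⇝x≤d𝟏 : (z ⇝ x) ≤ d 𝟏
    z⇝x≤d𝟏 = trans (cong ((z ⇝ x) ⇒_) (d𝟏≡dx⇝x x)) (⇝-antiˡ-≤ x dx≤z)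
    d[z⇝x]-atom : IsAtom (d (z ⇝ x))
    d[z⇝x]-atom = subst IsAtom (sym (d[z⇝x]≡φ dx≤z)) (φ-atom _)
    d[z⇝x]≡𝟏 : d (z ⇝ x) ≡ 𝟏
    d[z⇝x]≡𝟏 = sym (d[z⇝x]-atom 𝟏 (≤d𝟏⇒d≤𝟏 z⇝x≤d𝟏))
    z≤dx : z ≤ d x
    z≤dx = ⇝≡𝟏⇒≤ (begin
      z ⇝ d x              ≡⟨ cong (z ⇝_) (dx≡d𝟏⇒x x) ⟩
      z ⇝ (d 𝟏 ⇒ x)        ≡⟨ sym (⇒-⇝-exchange (d 𝟏) z x) ⟩
      d 𝟏 ⇒ (z ⇝ x)        ≡⟨ cong (d 𝟏 ⇒_) (d≡𝟏⇒≡d𝟏 d[z⇝x]≡𝟏) ⟩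
      d 𝟏 ⇒ d 𝟏            ≡⟨ x⇒x≡𝟏 (d 𝟏) ⟩
      𝟏                    ∎)

  dx≡φdx : ∀ x → d x ≡ φ (d x)
  dx≡φdx x = sym (d-atom x (φ (d x)) (x≤φx (d x)))

  d𝟏≡𝟏⇒d≗id : d 𝟏 ≡ 𝟏 → ∀ x → d x ≡ x
  d𝟏≡𝟏⇒d≗id d𝟏≡𝟏 x = trans (dx≡d𝟏⇒x x) (trans (cong (_⇒ x) d𝟏≡𝟏) (ax3 x))

proposition5p4 : ∀ {a : Level} (A : PseudoBCI a) → let open PseudoBCI A in
    (d : Carrier → Carrier) → IsTypeIISymDerivation d →
    (∀ x → (d 𝟏 ≡ (d x ⇒ x)) × (d 𝟏 ≡ (d x ⇝ x))) ×
    (∀ x → (d x ≡ φ (d x ⋓₁ x)) × (d x ≡ φ (d x ⋓₂ x))) ×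
    (∀ x → (d x ≡ (d x ⋓₁ x)) × (d x ≡ (d x ⋓₂ x))) ×
    (∀ x → IsAtom (d x)) ×
    (d 𝟏 ≡ 𝟏 → ∀ x → d x ≡ x)
proposition5p4 A d isDerivation =
  (λ x → d𝟏≡dx⇒x x , d𝟏≡dx⇝x x) ,
  (λ x → trans (dx≡φdx x) (cong φ (dx≡dx⋓₁x x)) , trans (dx≡φdx x) (cong φ (dx≡dx⋓₂x x))) ,
  (λ x → dx≡dx⋓₁x x , dx≡dx⋓₂x x) ,
  d-atom ,
  d𝟏≡𝟏⇒d≗id
  where
  open PseudoBCI A
  open TypeIISymDerivation A isDerivation
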